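{- Let $G$ be a bridgeless graph. Then $\mathsf{idf}(G)=\mathsf{vc}(G)$.
   Context: All graphs are finite, simple and undirected; bridgeless means no edge whose removal increases the number of connected components. $\mathsf{vc}(G)$ is the minimum size of a vertex cover of $G$. For $X\subseteq V(G)$, $G/\!\!/X$ is obtained from $G$ by deleting $X$ and adding a new vertex adjacent to every vertex of $N_G(X)=\bigcup_{v\in X}N_G(v)\setminus X$. For a partition $\mathcal{X}=\{X_1,\dots,X_p\}$ of some subset of $V(G)$ into non-empty parts, $G/\!\!/\mathcal{X}:=G/\!\!/X_1\cdots/\!\!/X_p$, with order $|X_1\cup\dots\cup X_p|$. $\mathsf{idf}(G)$ is the minimum order of such $\mathcal{X}$ with $G/\!\!/\mathcal{X}$ acyclic. -}

module Defs where

open import Data.Nat using (ℕ; zero; suc; _≤_)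
open import Data.Bool using (Bool; true; false)
open import Data.Fin using (Fin; inject₁; fromℕ) renaming (zero to fzero; suc to fsuc)
open import Data.Fin.Subset using (Subset; _∈_; _∉_; ∣_∣; Nonempty)
open import Data.Maybe using (Maybe; just; nothing)
open import Data.List using (List; []; _∷_; map)
open import Data.Nat.ListAction using (sum)
open import Data.List.Relation.Unary.All using (All)
open import Data.List.Relation.Unary.AllPairs using (AllPairs)
open import Data.Product using (Σ; ∃; _×_; _,_; proj₂)
open import Data.Sum using (_⊎_)
open import Data.Unit using (⊤)
open import Data.Empty using (⊥)
open import Relation.Nullary using (¬_)
open import Relation.Binary.PropositionalEquality using (_≡_)
open import Relation.Binary.Construct.Closure.ReflexiveTransitive using (Star)

record SimpleGraph (n : ℕ) : Set where
  field
    adj    : Fin n → Fin n → Bool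
    sym    : ∀ u v → adj u v ≡ adj v u
    irrefl : ∀ v → adj v v ≡ false

open SimpleGraph public

Adj : ∀ {n} → SimpleGraph n → Fin n → Fin n → Set
Adj G u v = adj G u v ≡ true

-- General graphs on a subset of an ambient type A (used for contractions)

record Graph (A : Set) : Set₁ where
  field
    Vtx  : A → Set
    Edge : A → A → Set

open Graph public

toGraph : ∀ {n} → SimpleGraph n → Graph (Fin n)
toGraph G = record { Vtx = λ _ → ⊤ ; Edge = Adj G }

Connected : ∀ {A} → Graph A → A → A → Set
Connected H = Star (Edge H)

record Cycle {A : Set} (H : Graph A) : Set where
  field
    j     : ℕ
    f     : Fin (suc (suc (suc j))) → A
    inV   : ∀ i → Vtx H (f i)
    inj   : ∀ i k → f i ≡ f k → i ≡ k
    step  : ∀ (i : Fin (suc (suc j))) → Edge H (f (inject₁ i)) (f (fsuc i))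
    close : Edge H (f (fromℕ (suc (suc j)))) (f fzero)

Acyclic : ∀ {A} → Graph A → Set
Acyclic H = ¬ Cycle H

removeEdge : ∀ {n} → SimpleGraph n → Fin n → Fin n → Graph (Fin n)
removeEdge G u v = record
  { Vtx  = λ _ → ⊤
  ; Edge = λ a b → Adj G a b × ¬ (a ≡ u × b ≡ v) × ¬ (a ≡ v × b ≡ u) }

-- uv is a bridge iff removing it increases the number of connected
-- components, i.e. some pair of vertices connected in G becomes
-- disconnected in G - uv (removing an edge only refines components).
IsBridge : ∀ {n} → SimpleGraph n → Fin n → Fin n → Set
IsBridge G u v = Adj G u v ×
  ∃ λ a → ∃ λ b → Connected (toGraph G) a b × ¬ Connected (removeEdge G u v) a b

Bridgeless : ∀ {n} → SimpleGraph n → Set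
Bridgeless G = ∀ u v → ¬ IsBridge G u v

IsVertexCover : ∀ {n} → SimpleGraph n → Subset n → Set
IsVertexCover G S = ∀ u v → Adj G u v → u ∈ S ⊎ v ∈ S

IsVC : ∀ {n} → SimpleGraph n → ℕ → Set
IsVC G k = (∃ λ S → IsVertexCover G S × ∣ S ∣ ≡ k)
         × (∀ S → IsVertexCover G S → k ≤ ∣ S ∣)

-- Identification  H // X  (X a subset of V(H)); new vertex = nothing

_//_ : ∀ {A} → Graph A → (A → Set) → Graph (Maybe A)
H // X = record { Vtx = V' ; Edge = E' }
  where
  V' : Maybe _ → Set
  V' (just v) = Vtx H v × ¬ X v
  V' nothing  = ⊤
  N : _ → Set
  N v = Vtx H v × ¬ X v × ∃ λ x → X x × Vtx H x × Edge H x v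
  E' : Maybe _ → Maybe _ → Set
  E' (just u) (just v) = Edge H u v × V' (just u) × V' (just v)
  E' nothing  (just v) = N v
  E' (just u) nothing  = N u
  E' nothing  nothing  = ⊥

Iter : ℕ → ℕ → Set
Iter n zero    = Fin n
Iter n (suc k) = Maybe (Iter n k)

emb : ∀ {n} k → Fin n → Iter n k
emb zero    x = x
emb (suc k) x = just (emb k x)

lift : ∀ {n} k → Subset n → Iter n k → Set
lift k X w = ∃ λ x → x ∈ X × emb k x ≡ w

contractAll : ∀ {n} k → Graph (Iter n k) → List (Subset n) → Σ ℕ λ m → Graph (Iter n m)
contractAll k H []       = k , H
contractAll k H (X ∷ Xs) = contractAll (suc k) (H // lift k X) Xs

_//ₚ_ : ∀ {n} → SimpleGraph n → List (Subset n) → Σ ℕ λ m → Graph (Iter n m)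
G //ₚ 𝒳 = contractAll zero (toGraph G) 𝒳

IsPartition : ∀ {n} → List (Subset n) → Set
IsPartition 𝒳 = All Nonempty 𝒳 × AllPairs (λ X Y → ∀ x → x ∈ X → x ∉ Y) 𝒳

order : ∀ {n} → List (Subset n) → ℕ
order 𝒳 = sum (map ∣_∣ 𝒳)

AcyclicAfter : ∀ {n} → SimpleGraph n → List (Subset n) → Set
AcyclicAfter G 𝒳 = Acyclic (proj₂ (G //ₚ 𝒳))

IsIDF : ∀ {n} → SimpleGraph n → ℕ → Set
IsIDF G k = (∃ λ 𝒳 → IsPartition 𝒳 × AcyclicAfter G 𝒳 × order 𝒳 ≡ k)
          × (∀ 𝒳 → IsPartition 𝒳 → AcyclicAfter G 𝒳 → k ≤ order 𝒳)

{-# OPTIONS --safe #-}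
module Submission where

open import Defs
open import Data.Nat using (ℕ; zero; suc; _≤_; _+_; s≤s; z≤n)
import Data.Nat.Properties as ℕ
open import Data.Bool using (true; false)
open import Data.Fin using (Fin; inject₁; fromℕ) renaming (zero to fzero; suc to fsuc)
import Data.Fin.Properties as Fin
open import Data.Fin.Subset using (Subset; _∈_; _∉_; ∣_∣; _∪_) renaming (⊥ to ∅)
open import Data.Fin.Subset.Properties
  using (_∈?_; x∈p∪q⁺; x∈p∪q⁻; ∉⊥; ∣⊥∣≡0; nonempty?; Empty-unique)
open import Data.Vec using ([]; _∷_)
open import Data.Maybe using (Maybe; just; nothing)
import Data.Maybe.Properties as Maybe
open import Data.List using (List; []; _∷_; length; lookup; foldl)
open import Data.List.Membership.Propositional.Properties using (∈-lookup)
open import Data.List.Relation.Unary.All as All using (All; []; _∷_)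
open import Data.List.Relation.Unary.All.Properties using (¬Any⇒All¬)
open import Data.List.Relation.Unary.Any using (Any; here; there; any?)
open import Data.List.Relation.Unary.AllPairs using (AllPairs; []; _∷_)
open import Data.List.Relation.Unary.Unique.Propositional using (Unique)
open import Data.Product using (Σ; ∃; _×_; _,_; proj₁; proj₂)
import Data.Product as Product
open import Data.Sum using (_⊎_; inj₁; inj₂; [_,_])
open import Data.Unit using (tt)
open import Data.Empty using (⊥; ⊥-elim)
open import Function using (id; _∘_; _⇔_; mk⇔)
open import Relation.Nullary using (¬_; yes; no)
open import Relation.Binary.Definitions using (DecidableEquality)
open import Relation.Binary.PropositionalEquality as ≡ using (_≡_; _≢_; refl; cong; subst)
open import Relation.Binary.Construct.Closure.ReflexiveTransitive using (Star; ε; _◅_; kleisliStar)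

-- A vertex cover S yields the single identification G // S, a star centred at the new
-- vertex, so idf ≤ vc. Conversely, let G // 𝒳 be acyclic and D the union of the parts.
-- An edge uv missing D survives as an edge between two distinct vertices of G // 𝒳.
-- Since uv is not a bridge, a u–v walk in G − uv maps to a walk in G // 𝒳 avoiding
-- that edge; shortened to a path and closed by the edge, it would be a cycle. Hence D
-- is a vertex cover of size at most the order of 𝒳, and vc ≤ idf.

∣p∪q∣≤∣p∣+∣q∣ : ∀ {n} (p q : Subset n) → ∣ p ∪ q ∣ ≤ ∣ p ∣ + ∣ q ∣
∣p∪q∣≤∣p∣+∣q∣ []          []          = z≤n
∣p∪q∣≤∣p∣+∣q∣ (true ∷ p)  (true ∷ q)  =
  s≤s (ℕ.≤-trans (∣p∪q∣≤∣p∣+∣q∣ p q) (ℕ.+-monoʳ-≤ ∣ p ∣ (ℕ.n≤1+n ∣ q ∣)))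
∣p∪q∣≤∣p∣+∣q∣ (true ∷ p)  (false ∷ q) = s≤s (∣p∪q∣≤∣p∣+∣q∣ p q)
∣p∪q∣≤∣p∣+∣q∣ (false ∷ p) (true ∷ q)  =
  ℕ.≤-trans (s≤s (∣p∪q∣≤∣p∣+∣q∣ p q)) (ℕ.≤-reflexive (≡.sym (ℕ.+-suc ∣ p ∣ ∣ q ∣)))
∣p∪q∣≤∣p∣+∣q∣ (false ∷ p) (false ∷ q) = ∣p∪q∣≤∣p∣+∣q∣ p q

∣foldl-∪∣≤∣p∣+order : ∀ {n} (D : Subset n) Xs → ∣ foldl _∪_ D Xs ∣ ≤ ∣ D ∣ + order Xs
∣foldl-∪∣≤∣p∣+order D [] = ℕ.≤-reflexive (≡.sym (ℕ.+-identityʳ ∣ D ∣))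
∣foldl-∪∣≤∣p∣+order D (X ∷ Xs) = begin
  ∣ foldl _∪_ (D ∪ X) Xs ∣   ≤⟨ ∣foldl-∪∣≤∣p∣+order (D ∪ X) Xs ⟩
  ∣ D ∪ X ∣ + order Xs       ≤⟨ ℕ.+-monoˡ-≤ (order Xs) (∣p∪q∣≤∣p∣+∣q∣ D X) ⟩
  ∣ D ∣ + ∣ X ∣ + order Xs   ≡⟨ ℕ.+-assoc ∣ D ∣ ∣ X ∣ (order Xs) ⟩
  ∣ D ∣ + order (X ∷ Xs)     ∎
  where open ℕ.≤-Reasoning

lookup-injective : ∀ {A : Set} {xs : List A} → Unique xs → ∀ i j → lookup xs i ≡ lookup xs j → i ≡ j
lookup-injective (_ ∷ _) fzero fzero _ = refl
lookup-injective (x∉xs ∷ _) fzero (fsuc j) eq = ⊥-elim (All.lookup x∉xs (∈-lookup j) eq)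
lookup-injective (x∉xs ∷ _) (fsuc i) fzero eq = ⊥-elim (All.lookup x∉xs (∈-lookup i) (≡.sym eq))
lookup-injective (_ ∷ u) (fsuc i) (fsuc j) eq = cong fsuc (lookup-injective u i j eq)

module _ {A : Set} {R : A → A → Set} where

  -- Listing the vertices as s ∷ targets w makes the length of a walk r₁ ◅ r₂ ◅ w′
  -- reduce to 3 + length (targets w′), the shape demanded by Cycle.
  targets : ∀ {s t} → Star R s t → List A
  targets ε = []
  targets (_◅_ {j = y} _ w) = y ∷ targets w

  vertices : ∀ {s t} → Star R s t → List A
  vertices {s} w = s ∷ targets w

  lookup-vertices-step : ∀ {s t} (w : Star R s t) (i : Fin (length (targets w))) →
    R (lookup (vertices w) (inject₁ i)) (lookup (vertices w) (fsuc i))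
  lookup-vertices-step (r ◅ w) fzero = r
  lookup-vertices-step (r ◅ w) (fsuc i) = lookup-vertices-step w i

  lookup-vertices-last : ∀ {s t} (w : Star R s t) →
    lookup (vertices w) (fromℕ (length (targets w))) ≡ t
  lookup-vertices-last ε = refl
  lookup-vertices-last (r ◅ w) = lookup-vertices-last w

  vertices-All : ∀ {P : A → Set} → (∀ {p q} → R p q → P q) →
    ∀ {s t} → P s → (w : Star R s t) → All P (vertices w)
  vertices-All R⇒P Ps ε = Ps ∷ []
  vertices-All R⇒P Ps (r ◅ w) = Ps ∷ vertices-All R⇒P (R⇒P r) w

Path : ∀ {A} → (A → A → Set) → A → A → Set
Path R s t = Σ (Star R s t) λ w → Unique (vertices w)

module _ {A : Set} {R : A → A → Set} where

  suffix-from : ∀ {s x t} (w : Star R x t) → Any (s ≡_) (vertices w) → Unique (vertices w) →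
    Path R s t
  suffix-from w (here refl) u = w , u
  suffix-from ε (there ())
  suffix-from (_ ◅ w) (there s∈w) (_ ∷ u) = suffix-from w s∈w u

  shortcut : DecidableEquality A → ∀ {s t} → Star R s t → Path R s t
  shortcut _≟_ ε = ε , [] ∷ []
  shortcut _≟_ {s} (r ◅ w) with shortcut _≟_ w
  ... | p , u with any? (s ≟_) (vertices p)
  ...   | yes s∈p = suffix-from p s∈p u
  ...   | no s∉p = r ◅ p , ¬Any⇒All¬ _ s∉p ∷ u

module _ {A : Set} where

  Arc : Graph A → A → A → Set
  Arc H p q = Edge H p q × Vtx H q

  deleteEdge : Graph A → A → A → Graph A
  deleteEdge H s t = record
    { Vtx  = Vtx H
    ; Edge = λ p q → Edge H p q × ¬ (p ≡ s × q ≡ t) × ¬ (p ≡ t × q ≡ s) }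

  cycle-from-detour : ∀ {H : Graph A} {s t} → s ≢ t → Vtx H s → Edge H t s →
    Path (Arc (deleteEdge H s t)) s t → Cycle H
  cycle-from-detour s≢t _ _ (ε , _) = ⊥-elim (s≢t refl)
  cycle-from-detour _ _ _ (((_ , ¬st , _) , _) ◅ ε , _) = ⊥-elim (¬st (refl , refl))
  cycle-from-detour {H} {s} s≢t Vs ts (w@(_ ◅ _ ◅ w′) , u) = record
    { j     = length (targets w′)
    ; f     = lookup (vertices w)
    ; inV   = λ i → All.lookup (vertices-All (λ (_ , Vq) → Vq) Vs w) (∈-lookup i)
    ; inj   = lookup-injective u
    ; step  = λ i → let ((e , _) , _) = lookup-vertices-step w i in e
    ; close = subst (λ p → Edge H p s) (≡.sym (lookup-vertices-last w)) ts
    }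

  IsStarAt : Graph A → A → Set
  IsStarAt H c = ∀ {p q} → Edge H p q → p ≡ c ⊎ q ≡ c

  star⇒acyclic : ∀ {H c} → IsStarAt H c → Acyclic H
  star⇒acyclic {c = c} star C = meets (star (step fzero)) (star (step (fsuc fzero))) (star close)
    where
    open Cycle C
    once : ∀ {i k} → f i ≡ c → f k ≡ c → i ≡ k
    once fi≡c fk≡c = inj _ _ (≡.trans fi≡c (≡.sym fk≡c))
    meets : f fzero ≡ c ⊎ f (fsuc fzero) ≡ c → f (fsuc fzero) ≡ c ⊎ f (fsuc (fsuc fzero)) ≡ c →
            f (fromℕ (suc (suc j))) ≡ c ⊎ f fzero ≡ c → ⊥
    meets (inj₁ f₀≡c) (inj₁ f₁≡c) _ with once f₀≡c f₁≡c
    ... | ()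
    meets (inj₁ f₀≡c) (inj₂ f₂≡c) _ with once f₀≡c f₂≡c
    ... | ()
    meets (inj₂ f₁≡c) _ (inj₁ fₗ≡c) with once fₗ≡c f₁≡c
    ... | ()
    meets (inj₂ f₁≡c) _ (inj₂ f₀≡c) with once f₀≡c f₁≡c
    ... | ()

  edgeless⇒acyclic : ∀ {H : Graph A} → (∀ {p q} → ¬ Edge H p q) → Acyclic H
  edgeless⇒acyclic edgeless C = edgeless (Cycle.step C fzero)

emb-injective : ∀ {n} k {x y : Fin n} → emb k x ≡ emb k y → x ≡ y
emb-injective zero eq = eq
emb-injective (suc k) eq = emb-injective k (Maybe.just-injective eq)

Iter-≟ : ∀ {n} k → DecidableEquality (Iter n k)
Iter-≟ zero = Fin._≟_
Iter-≟ (suc k) = Maybe.≡-dec (Iter-≟ k)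

Adj-sym : ∀ {n} (G : SimpleGraph n) {a b} → Adj G a b → Adj G b a
Adj-sym G {a} {b} ab = ≡.trans (sym G b a) ab

Adj-irrefl : ∀ {n} (G : SimpleGraph n) {a} → ¬ Adj G a a
Adj-irrefl G {a} aa with ≡.trans (≡.sym (irrefl G a)) aa
... | ()

Disjoint : ∀ {n} → Subset n → Subset n → Set
Disjoint X Y = ∀ x → x ∈ X → x ∉ Y

Disjoint-∪ : ∀ {n} {D X Y : Subset n} → Disjoint Y D → Disjoint X Y → Disjoint Y (D ∪ X)
Disjoint-∪ {D = D} {X} Y∩D≡∅ X∩Y≡∅ y y∈Y y∈D∪X =
  [ Y∩D≡∅ y y∈Y , (λ y∈X → X∩Y≡∅ y y∈X y∈Y) ] (x∈p∪q⁻ D X y∈D∪X)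

collapse : ∀ {n} {B : Set} → Subset n → (Fin n → B) → Fin n → Maybe B
collapse X φ a with a ∈? X
... | yes _ = nothing
... | no _ = just (φ a)

module _ {n} (G : SimpleGraph n) where

  -- φ sends each vertex of G to the vertex of H it has been identified into, and D
  -- collects the vertices absorbed into new vertices so far.
  record Tracking (k : ℕ) (H : Graph (Iter n k)) (φ : Fin n → Iter n k) (D : Subset n) : Set where
    field
      image-vertex : ∀ a → Vtx H (φ a)
      fixes        : ∀ a → a ∉ D → φ a ≡ emb k a
      reflects-emb : ∀ a x → φ a ≡ emb k x → a ≡ x
      image-edge   : ∀ {a b} → Adj G a b → φ a ≡ φ b ⊎ Edge H (φ a) (φ b)

    injective-at : ∀ {u} → u ∉ D → ∀ a → φ a ≡ φ u → a ≡ u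
    injective-at u∉D a eq = reflects-emb a _ (≡.trans eq (fixes _ u∉D))

    adjacent-images-distinct : ∀ {a b} → b ∉ D → Adj G a b → φ a ≢ φ b
    adjacent-images-distinct b∉D ab φa≡φb with injective-at b∉D _ φa≡φb
    ... | refl = Adj-irrefl G ab

    image-edge-outside : ∀ {a b} → b ∉ D → Adj G a b → Edge H (φ a) (φ b)
    image-edge-outside b∉D ab with image-edge ab
    ... | inj₁ φa≡φb = ⊥-elim (adjacent-images-distinct b∉D ab φa≡φb)
    ... | inj₂ e = e

    image-detour : ∀ {u v} → u ∉ D → v ∉ D → ∀ {a b} → Star (Edge (removeEdge G u v)) a b →
      Star (Arc (deleteEdge H (φ u) (φ v))) (φ a) (φ b)
    image-detour {u} {v} u∉D v∉D = kleisliStar φ image-step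
      where
      image-step : ∀ {a b} → Edge (removeEdge G u v) a b →
        Star (Arc (deleteEdge H (φ u) (φ v))) (φ a) (φ b)
      image-step {a} {b} (ab , ab≢uv , ab≢vu) with image-edge ab
      ... | inj₁ φa≡φb = subst (Star _ (φ a)) φa≡φb ε
      ... | inj₂ e = ((e , ab≢uv ∘ Product.map (injective-at u∉D a) (injective-at v∉D b)
                         , ab≢vu ∘ Product.map (injective-at v∉D a) (injective-at u∉D b))
                     , image-vertex b) ◅ ε

  module _ {k H φ D} (tr : Tracking k H φ D) {X : Subset n} (X∩D≡∅ : Disjoint X D) where
    open Tracking tr

    image∉lift : ∀ {a} → a ∉ X → ¬ lift k X (φ a)
    image∉lift a∉X (x , x∈X , eq) = a∉X (subst (_∈ X) (≡.sym (reflects-emb _ x (≡.sym eq))) x∈X)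

    embedded-in-X : ∀ {a} → a ∈ X → lift k X (φ a)
    embedded-in-X {a} a∈X = a , a∈X , ≡.sym (fixes a (X∩D≡∅ a a∈X))

    edge-from-X : ∀ {a b} → a ∈ X → b ∉ X → Adj G a b → Edge (H // lift k X) nothing (just (φ b))
    edge-from-X {a} {b} a∈X b∉X ab with image-edge ab
    ... | inj₁ φa≡φb = ⊥-elim (image∉lift b∉X (subst (lift k X) φa≡φb (embedded-in-X a∈X)))
    ... | inj₂ e = image-vertex b , image∉lift b∉X , φ a , embedded-in-X a∈X , image-vertex a , e

    tracking-// : Tracking (suc k) (H // lift k X) (collapse X φ) (D ∪ X)
    tracking-// = record
      { image-vertex = vertex′
      ; fixes        = fixes′
      ; reflects-emb = reflects′
      ; image-edge   = edge′
      }
      where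
      vertex′ : ∀ a → Vtx (H // lift k X) (collapse X φ a)
      vertex′ a with a ∈? X
      ... | yes _ = tt
      ... | no a∉X = image-vertex a , image∉lift a∉X

      fixes′ : ∀ a → a ∉ D ∪ X → collapse X φ a ≡ emb (suc k) a
      fixes′ a a∉D∪X with a ∈? X
      ... | yes a∈X = ⊥-elim (a∉D∪X (x∈p∪q⁺ (inj₂ a∈X)))
      ... | no _ = cong just (fixes a (a∉D∪X ∘ x∈p∪q⁺ ∘ inj₁))

      reflects′ : ∀ a x → collapse X φ a ≡ emb (suc k) x → a ≡ x
      reflects′ a x eq with a ∈? X
      reflects′ a x () | yes _
      ... | no _ = reflects-emb a x (Maybe.just-injective eq)

      edge′ : ∀ {a b} → Adj G a b →
        collapse X φ a ≡ collapse X φ b ⊎ Edge (H // lift k X) (collapse X φ a) (collapse X φ b)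
      edge′ {a} {b} ab with a ∈? X | b ∈? X
      ... | yes _   | yes _   = inj₁ refl
      ... | yes a∈X | no b∉X  = inj₂ (edge-from-X a∈X b∉X ab)
      ... | no a∉X  | yes b∈X = inj₂ (edge-from-X b∈X a∉X (Adj-sym G ab))
      ... | no a∉X  | no b∉X with image-edge ab
      ...   | inj₁ φa≡φb = inj₁ (cong just φa≡φb)
      ...   | inj₂ e =
        inj₂ (e , (image-vertex a , image∉lift a∉X) , (image-vertex b , image∉lift b∉X))

  tracking-contractAll : ∀ {k H φ D} Xs → Tracking k H φ D →
    All (λ X → Disjoint X D) Xs → AllPairs Disjoint Xs →
    ∃ λ ψ → Tracking (proj₁ (contractAll k H Xs)) (proj₂ (contractAll k H Xs)) ψ (foldl _∪_ D Xs)
  tracking-contractAll [] tr _ _ = _ , tr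
  tracking-contractAll (X ∷ Xs) tr (X∩D≡∅ ∷ Xs∩D≡∅) (X∩Xs≡∅ ∷ Xs-disjoint) =
    tracking-contractAll Xs (tracking-// tr X∩D≡∅)
      (All.zipWith (λ (Y∩D≡∅ , X∩Y≡∅) → Disjoint-∪ Y∩D≡∅ X∩Y≡∅) (Xs∩D≡∅ , X∩Xs≡∅)) Xs-disjoint

  tracking-id : Tracking 0 (toGraph G) id ∅
  tracking-id = record
    { image-vertex = λ _ → tt
    ; fixes        = λ _ _ → refl
    ; reflects-emb = λ _ _ eq → eq
    ; image-edge   = inj₂
    }

  tracking⇒cover : Bridgeless G → ∀ {k H φ D} → Tracking k H φ D → Acyclic H → IsVertexCover G D
  tracking⇒cover bridgeless {k} {D = D} tr acyclic u v uv with u ∈? D | v ∈? D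
  ... | yes u∈D | _ = inj₁ u∈D
  ... | no _ | yes v∈D = inj₂ v∈D
  ... | no u∉D | no v∉D = ⊥-elim (bridgeless u v (uv , u , v , uv ◅ ε , no-detour))
    where
    open Tracking tr
    no-detour : ¬ Connected (removeEdge G u v) u v
    no-detour detour = acyclic (cycle-from-detour
      (adjacent-images-distinct v∉D uv) (image-vertex u) (image-edge-outside u∉D (Adj-sym G uv))
      (shortcut (Iter-≟ k) (image-detour u∉D v∉D detour)))

  acyclic-identification⇒cover : Bridgeless G → ∀ {𝒳} → IsPartition 𝒳 → AcyclicAfter G 𝒳 →
    ∃ λ D → IsVertexCover G D × ∣ D ∣ ≤ order 𝒳
  acyclic-identification⇒cover bridgeless {𝒳} (_ , disjoint) acyclic =
    let (_ , tr) = tracking-contractAll 𝒳 tracking-id (All.universal (λ _ _ _ → ∉⊥) 𝒳) disjoint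
    in  foldl _∪_ ∅ 𝒳 , tracking⇒cover bridgeless tr acyclic ,
        subst (λ m → ∣ foldl _∪_ ∅ 𝒳 ∣ ≤ m + order 𝒳) (∣⊥∣≡0 n) (∣foldl-∪∣≤∣p∣+order ∅ 𝒳)

  cover⇒acyclic-identification : ∀ {S} → IsVertexCover G S →
    ∃ λ 𝒳 → IsPartition 𝒳 × AcyclicAfter G 𝒳 × order 𝒳 ≡ ∣ S ∣
  cover⇒acyclic-identification {S} cover with nonempty? S
  ... | yes S≢∅ = S ∷ [] , (S≢∅ ∷ [] , [] ∷ []) , star⇒acyclic centre , ℕ.+-identityʳ ∣ S ∣
    where
    centre : IsStarAt (toGraph G // lift 0 S) nothing
    centre {just a} {just b} (ab , (_ , a∉S) , (_ , b∉S)) =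
      ⊥-elim ([ (λ a∈S → a∉S (a , a∈S , refl)) , (λ b∈S → b∉S (b , b∈S , refl)) ] (cover a b ab))
    centre {nothing} _ = inj₁ refl
    centre {just _} {nothing} _ = inj₂ refl
  ... | no S≡∅ = [] , ([] , []) , edgeless⇒acyclic no-edge , ≡.sym ∣S∣≡0
    where
    no-edge : ∀ {a b} → ¬ Adj G a b
    no-edge ab = [ (λ a∈S → S≡∅ (_ , a∈S)) , (λ b∈S → S≡∅ (_ , b∈S)) ] (cover _ _ ab)
    ∣S∣≡0 : ∣ S ∣ ≡ 0
    ∣S∣≡0 = ≡.trans (cong ∣_∣ (Empty-unique S≡∅)) (∣⊥∣≡0 n)

lemma3p4 : ∀ {n} (G : SimpleGraph n) → Bridgeless G →
    ∀ (k : ℕ) → IsIDF G k ⇔ IsVC G k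
lemma3p4 G bridgeless k = mk⇔ idf⇒vc vc⇒idf
  where
  idf⇒vc : IsIDF G k → IsVC G k
  idf⇒vc ((𝒳 , partition , acyclic , refl) , idf-minimal)
    with acyclic-identification⇒cover G bridgeless partition acyclic
  ... | D , D-cover , ∣D∣≤k = (D , D-cover , ℕ.≤-antisym ∣D∣≤k (k≤vc D D-cover)) , k≤vc
    where
    k≤vc : ∀ S → IsVertexCover G S → order 𝒳 ≤ ∣ S ∣
    k≤vc S S-cover =
      let (𝒴 , 𝒴-partition , 𝒴-acyclic , order≡∣S∣) = cover⇒acyclic-identification G S-cover
      in  subst (order 𝒳 ≤_) order≡∣S∣ (idf-minimal 𝒴 𝒴-partition 𝒴-acyclic)

  vc⇒idf : IsVC G k → IsIDF G k
  vc⇒idf ((S , S-cover , refl) , vc-minimal) = cover⇒acyclic-identification G S-cover , k≤idf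
    where
    k≤idf : ∀ 𝒳 → IsPartition 𝒳 → AcyclicAfter G 𝒳 → ∣ S ∣ ≤ order 𝒳
    k≤idf 𝒳 partition acyclic =
      let (D , D-cover , ∣D∣≤order) = acyclic-identification⇒cover G bridgeless partition acyclic
      in  ℕ.≤-trans (vc-minimal D D-cover) ∣D∣≤order
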